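{- For every $t\in T^*$, the tiling $S_t$ is self-similar, i.e. there exists an integer $n\ge 1$ such that $\sigma^n(S_t)=S_t$ (where $\sigma^n$ is applied to every tile of $S_t$, with inflation by $2^n$ about the centroid of the central tile of $S_t$).
   Context: Let $p$ be an odd prime and $\mathbb{F}_p$ the field with $p$ elements. A tile is a unit equilateral triangle of the standard triangular lattice in the plane, oriented upward or downward, whose three corners are decorated with elements of $\mathbb{F}_p$. $\triangle(x,y,z)$ denotes the upward tile whose bottom-left, bottom-right and top corners carry $x,y,z$; $\triangledown(x,y,z)$ the downward tile whose top-right, top-left and bottom corners carry $x,y,z$. $T$ is the set of all such tiles, $T^*=T\setminus\{\triangle(0,0,0),\triangledown(0,0,0)\}$. The substitution $\sigma$ inflates a tile by factor $2$ and replaces it by four unit tiles: $\sigma(\triangle(x,y,z))$ consists of bottom-left $\triangle(x,x+y,x+z)$, bottom-right $\triangle(x+y,y,y+z)$, top $\triangle(x+z,y+z,z)$ and central $\triangledown(y+z,x+z,x+y)$; $\sigma(\triangledown(x,y,z))$ consists of top-right $\triangledown(x,x+y,x+z)$, top-left $\triangledown(x+y,y,y+z)$, bottom $\triangledown(x+z,y+z,z)$ and central $\triangle(y+z,x+z,x+y)$. $\sigma$ acts on patches and tilings tile by tile. Let $\alpha:T\to T$ map a tile $t$ to the central tile of $\sigma(t)$; $\alpha$ is a bijection of $T$. For $t\in T$ and $k\in\mathbb{N}$ let $s_t(k)=\sigma^k(\alpha^{ -k}(t))$, a triangle of side $2^k$ made of $4^k$ decorated unit tiles whose central tile is $t$;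 place each $s_t(k)$ so that its central tile occupies a fixed position (centroid at the origin). Then $s_t(k)$ is the central sub-triangle of $s_t(k+1)$, and the union of the nested patches $s_t(k)$ is a decorated tiling of the plane denoted $S_t$. -}

module Defs where

open import Data.Nat as ℕ using (ℕ; zero; suc; NonZero)
open import Data.Nat.DivMod using (_mod_)
open import Data.Fin using (Fin; toℕ)
open import Data.Integer as ℤ using (ℤ)
open import Data.Product using (_×_; _,_; Σ; ∃; ∃-syntax)
open import Data.List using (List; []; _∷_)
open import Data.List.Membership.Propositional using (_∈_)
open import Relation.Binary.PropositionalEquality using (_≡_; _≢_)

-- The field F_p: elements Fin p, addition modulo p.
-- (Only addition of F_p is used by the substitution.)
module _ {p : ℕ} .{{_ : NonZero p}} where

  infixl 6 _⊕_
  _⊕_ : Fin p → Fin p → Fin p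
  a ⊕ b = (toℕ a ℕ.+ toℕ b) mod p

  𝟘 : Fin p
  𝟘 = 0 mod p

-- Decorated tiles.
-- up x y z   = △(x,y,z): bottom-left, bottom-right, top corners.
-- down x y z = ▽(x,y,z): top-right, top-left, bottom corners.
data Tile (p : ℕ) : Set where
  up   : Fin p → Fin p → Fin p → Tile p
  down : Fin p → Fin p → Fin p → Tile p

NonZeroTile : {p : ℕ} .{{_ : NonZero p}} → Tile p → Set
NonZeroTile t = (t ≢ up 𝟘 𝟘 𝟘) × (t ≢ down 𝟘 𝟘 𝟘)

-- Positions: a unit tile is located by its centroid.  With the origin at the
-- centroid of the central tile and e1 = (1,0), e2 = (1/2, √3/2), every
-- centroid of a lattice triangle lies in (1/3)ℤ e1 + (1/3)ℤ e2; the pair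
-- (a , b) : ℤ × ℤ denotes the point (a/3) e1 + (b/3) e2.
Pos : Set
Pos = ℤ × ℤ

origin : Pos
origin = ℤ.+ 0 , ℤ.+ 0

infl : Pos → ℤ → ℤ → Pos
infl (x , y) a b = (x ℤ.+ x ℤ.+ a) , (y ℤ.+ y ℤ.+ b)

Tiling : ℕ → Set₁
Tiling p = Pos → Tile p → Set

module _ {p : ℕ} .{{_ : NonZero p}} where

  -- σ on one placed tile: inflation by 2 about the origin, then subdivision.
  -- Offsets of child centroids from the doubled parent centroid (in thirds).
  children : Pos → Tile p → List (Pos × Tile p)
  children P (up x y z) =
      (infl P (ℤ.- ℤ.+ 1) (ℤ.- ℤ.+ 1) , up x (x ⊕ y) (x ⊕ z))
    ∷ (infl P (ℤ.+ 2) (ℤ.- ℤ.+ 1) , up (x ⊕ y) y (y ⊕ z))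
    ∷ (infl P (ℤ.- ℤ.+ 1) (ℤ.+ 2) , up (x ⊕ z) (y ⊕ z) z)
    ∷ (infl P (ℤ.+ 0) (ℤ.+ 0) , down (y ⊕ z) (x ⊕ z) (x ⊕ y))
    ∷ []
  children P (down x y z) =
      (infl P (ℤ.+ 1) (ℤ.+ 1) , down x (x ⊕ y) (x ⊕ z))
    ∷ (infl P (ℤ.- ℤ.+ 2) (ℤ.+ 1) , down (x ⊕ y) y (y ⊕ z))
    ∷ (infl P (ℤ.+ 1) (ℤ.- ℤ.+ 2) , down (x ⊕ z) (y ⊕ z) z)
    ∷ (infl P (ℤ.+ 0) (ℤ.+ 0) , up (y ⊕ z) (x ⊕ z) (x ⊕ y))
    ∷ []

  σ : Tiling p → Tiling p
  σ R Q τ = ∃[ P ] ∃[ t ] (R P t × ((Q , τ) ∈ children P t))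

  σ^ : ℕ → Tiling p → Tiling p
  σ^ zero    R = R
  σ^ (suc n) R = σ (σ^ n R)

  -- α : central tile of σ(t)
  α : Tile p → Tile p
  α (up x y z)   = down (y ⊕ z) (x ⊕ z) (x ⊕ y)
  α (down x y z) = up (y ⊕ z) (x ⊕ z) (x ⊕ y)

  α^ : ℕ → Tile p → Tile p
  α^ zero    t = t
  α^ (suc n) t = α (α^ n t)

  single : Tile p → Tiling p
  single u Q τ = (Q ≡ origin) × (τ ≡ u)

  -- s_t(k) = σ^k(α^{-k}(t)) : since α is a bijection, α^{-k}(t) is the unique u
  -- with α^k u ≡ t.
  s : Tile p → ℕ → Tiling p
  s t k Q τ = ∃[ u ] ((α^ k u ≡ t) × σ^ k (single u) Q τ)

  S : Tile p → Tiling p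
  S t Q τ = ∃[ k ] s t k Q τ

  _≐_ : Tiling p → Tiling p → Set
  R ≐ R' = ∀ Q τ → (R Q τ → R' Q τ) × (R' Q τ → R Q τ)

-- The central tile of σ(u), with u at the origin, is α(u), again at the origin.
-- Hence if α^m t = t then σ^m maps s_t(k) into s_t(m + k).  Conversely, write
-- s_t(k) = σ^k(u) with α^k u = t; injectivity of α forces α^m u = u, so u lies
-- in σ^m(u) and s_t(k) lies in σ^m(s_t(k)).  Such an m ≥ 1 exists because α is
-- injective on the finite set of tiles: on corners it is
-- (x,y,z) ↦ (y+z, x+z, x+y), and (x+y) + (x+z) - (y+z) = 2x, where 2 is
-- invertible in F_p as p is odd.
module Submission where

open import Defs
open import Level using (0ℓ)
open import Algebra.Bundles using (AbelianGroup)
import Algebra.Properties.Group as GroupProperties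
import Algebra.Properties.CommutativeSemigroup as CommutativeSemigroupProperties
open import Data.Nat as ℕ using (ℕ; NonZero; zero; suc; _+_; _∸_; _<_; _≥_; >-nonZero⁻¹)
open import Data.Nat.Properties using (+-assoc; +-comm; +-identityʳ; n<1+n; <⇒≤; m<n⇒0<n∸m; m+[n∸m]≡n)
open import Data.Nat.DivMod using (_%_; _mod_; %-distribˡ-+; m%n%n≡m%n; n%n≡0; m<n⇒m%n≡m; m%n<n)
open import Data.Nat.Divisibility using (_∣_; >⇒∤; m%n≡0⇒n∣m)
open import Data.Nat.Coprimality using (Coprime; coprime-divisor)
open import Data.Nat.Primality using (Prime; irreducible[2])
open import Data.Nat.GeneralisedArithmetic using (fold; fold-+)
open import Data.Fin using (Fin; toℕ)
open import Data.Fin.Properties using (toℕ-fromℕ<; toℕ-injective; toℕ<n; pigeonhole; +↔⊎; *↔×)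
open import Data.Product using (_×_; _,_; ∃-syntax)
open import Data.Product.Properties using (,-injective)
open import Data.Product.Algebra using (×-cong)
open import Data.Sum using (_⊎_; inj₁; inj₂)
open import Data.Sum.Algebra using (⊎-cong)
open import Data.List.Relation.Unary.Any using (here; there)
open import Data.List.Membership.Propositional using (_∈_)
open import Function.Bundles using (_↔_; _↣_; mk↔ₛ′; Injection)
open import Function.Definitions using (Injective)
open import Function.Properties.Inverse using (↔-refl; ↔-sym; ↔-trans; ↔⇒↣)
open import Relation.Binary.PropositionalEquality
  using (_≡_; refl; sym; trans; cong; cong₂; subst; module ≡-Reasoning)
open import Relation.Binary.PropositionalEquality.Algebra using (isMagma)
open import Relation.Nullary using (¬_; contradiction)

open ≡-Reasoning

odd⇒coprime-2 : ∀ {n} → ¬ 2 ∣ n → Coprime n 2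
odd⇒coprime-2 2∤n (d∣n , d∣2) with irreducible[2] d∣2
... | inj₁ d≡1 = d≡1
... | inj₂ refl = contradiction d∣n 2∤n

odd-∣-double⇒∣ : ∀ {m n} → ¬ 2 ∣ m → m ∣ n + n → m ∣ n
odd-∣-double⇒∣ {m} {n} 2∤m m∣2n =
  coprime-divisor (odd⇒coprime-2 2∤m) (subst (m ∣_) (cong (n +_) (sym (+-identityʳ n))) m∣2n)

∣∧<⇒≡0 : ∀ {m n} → m ∣ n → n < m → n ≡ 0
∣∧<⇒≡0 {n = zero}  _   _   = refl
∣∧<⇒≡0 {n = suc _} m∣n n<m = contradiction m∣n (>⇒∤ n<m)

[m%d+n]%d≡[m+n]%d : ∀ m n d .{{_ : NonZero d}} → (m % d + n) % d ≡ (m + n) % d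
[m%d+n]%d≡[m+n]%d m n d = begin
  (m % d + n) % d         ≡⟨ %-distribˡ-+ (m % d) n d ⟩
  (m % d % d + n % d) % d ≡⟨ cong (λ x → (x + n % d) % d) (m%n%n≡m%n m d) ⟩
  (m % d + n % d) % d     ≡⟨ %-distribˡ-+ m n d ⟨
  (m + n) % d             ∎

[m+n%d]%d≡[m+n]%d : ∀ m n d .{{_ : NonZero d}} → (m + n % d) % d ≡ (m + n) % d
[m+n%d]%d≡[m+n]%d m n d = begin
  (m + n % d) % d ≡⟨ cong (_% d) (+-comm m (n % d)) ⟩
  (n % d + m) % d ≡⟨ [m%d+n]%d≡[m+n]%d n m d ⟩
  (n + m) % d     ≡⟨ cong (_% d) (+-comm n m) ⟩
  (m + n) % d     ∎

module _ {A : Set} {f : A → A} (f-injective : Injective _≡_ _≡_ f) where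

  fold-injective : ∀ k → Injective _≡_ _≡_ (λ a → fold a f k)
  fold-injective zero    eq = eq
  fold-injective (suc k) eq = fold-injective k (f-injective eq)

  -- Pigeonhole gives fold a f i ≡ fold a f j with i < j; cancel the first i steps.
  injective⇒periodic : ∀ {n} → A ↣ Fin n → ∀ a → ∃[ m ] (m ≥ 1 × fold a f m ≡ a)
  injective⇒periodic {n} A↣Fin a
    with i , j , i<j , eq ← pigeonhole (n<1+n n) (λ i → Injection.to A↣Fin (fold a f (toℕ i)))
    = toℕ j ∸ toℕ i , m<n⇒0<n∸m i<j , fold-injective (toℕ i) (begin
        fold (fold a f (toℕ j ∸ toℕ i)) f (toℕ i) ≡⟨ fold-+ a f (toℕ i) ⟨
        fold a f (toℕ i + (toℕ j ∸ toℕ i))        ≡⟨ cong (fold a f) (m+[n∸m]≡n (<⇒≤ i<j)) ⟩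
        fold a f (toℕ j)                          ≡⟨ Injection.injective A↣Fin eq ⟨
        fold a f (toℕ i)                          ∎)

Cube : ℕ → Set
Cube p = Fin p × Fin p × Fin p

Tile↔Cube⊎Cube : ∀ {p} → Tile p ↔ (Cube p ⊎ Cube p)
Tile↔Cube⊎Cube = mk↔ₛ′ toSum fromSum
  (λ { (inj₁ _) → refl ; (inj₂ _) → refl })
  (λ { (up _ _ _) → refl ; (down _ _ _) → refl })
  where
  toSum : Tile _ → Cube _ ⊎ Cube _
  toSum (up x y z)   = inj₁ (x , y , z)
  toSum (down x y z) = inj₂ (x , y , z)
  fromSum : Cube _ ⊎ Cube _ → Tile _
  fromSum (inj₁ (x , y , z)) = up x y z
  fromSum (inj₂ (x , y , z)) = down x y z

Tile↔Fin : ∀ {p} → Tile p ↔ Fin (p ℕ.* (p ℕ.* p) + p ℕ.* (p ℕ.* p))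
Tile↔Fin = ↔-trans Tile↔Cube⊎Cube (↔-sym (↔-trans +↔⊎ (⊎-cong Fin↔Cube Fin↔Cube)))
  where Fin↔Cube = ↔-trans *↔× (×-cong ↔-refl *↔×)

module _ {p : ℕ} .{{_ : NonZero p}} where

  toℕ-⊕ : ∀ (a b : Fin p) → toℕ (a ⊕ b) ≡ (toℕ a + toℕ b) % p
  toℕ-⊕ a b = toℕ-fromℕ< (m%n<n (toℕ a + toℕ b) p)

  toℕ-𝟘 : toℕ (𝟘 {p}) ≡ 0
  toℕ-𝟘 = trans (toℕ-fromℕ< (m%n<n 0 p)) (m<n⇒m%n≡m (>-nonZero⁻¹ p))

  ⊕-comm : ∀ (a b : Fin p) → a ⊕ b ≡ b ⊕ a
  ⊕-comm a b = cong (_mod p) (+-comm (toℕ a) (toℕ b))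

  ⊕-assoc : ∀ (a b c : Fin p) → (a ⊕ b) ⊕ c ≡ a ⊕ (b ⊕ c)
  ⊕-assoc a b c = toℕ-injective (begin
    toℕ ((a ⊕ b) ⊕ c)                   ≡⟨ toℕ-⊕ (a ⊕ b) c ⟩
    (toℕ (a ⊕ b) + toℕ c) % p           ≡⟨ cong (λ x → (x + toℕ c) % p) (toℕ-⊕ a b) ⟩
    ((toℕ a + toℕ b) % p + toℕ c) % p   ≡⟨ [m%d+n]%d≡[m+n]%d (toℕ a + toℕ b) (toℕ c) p ⟩
    (toℕ a + toℕ b + toℕ c) % p         ≡⟨ cong (_% p) (+-assoc (toℕ a) (toℕ b) (toℕ c)) ⟩
    (toℕ a + (toℕ b + toℕ c)) % p       ≡⟨ [m+n%d]%d≡[m+n]%d (toℕ a) (toℕ b + toℕ c) p ⟨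
    (toℕ a + (toℕ b + toℕ c) % p) % p   ≡⟨ cong (λ x → (toℕ a + x) % p) (toℕ-⊕ b c) ⟨
    (toℕ a + toℕ (b ⊕ c)) % p           ≡⟨ toℕ-⊕ a (b ⊕ c) ⟨
    toℕ (a ⊕ (b ⊕ c))                   ∎)

  ⊕-identityʳ : ∀ (a : Fin p) → a ⊕ 𝟘 ≡ a
  ⊕-identityʳ a = toℕ-injective (begin
    toℕ (a ⊕ 𝟘)             ≡⟨ toℕ-⊕ a 𝟘 ⟩
    (toℕ a + toℕ 𝟘) % p     ≡⟨ cong (λ x → (toℕ a + x) % p) toℕ-𝟘 ⟩
    (toℕ a + 0) % p         ≡⟨ cong (_% p) (+-identityʳ (toℕ a)) ⟩
    toℕ a % p               ≡⟨ m<n⇒m%n≡m (toℕ<n a) ⟩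
    toℕ a                   ∎)

  ⊖_ : Fin p → Fin p
  ⊖ a = (p ∸ toℕ a) mod p

  ⊕-inverseʳ : ∀ (a : Fin p) → a ⊕ ⊖ a ≡ 𝟘
  ⊕-inverseʳ a = toℕ-injective (begin
    toℕ (a ⊕ ⊖ a)                       ≡⟨ toℕ-⊕ a (⊖ a) ⟩
    (toℕ a + toℕ (⊖ a)) % p             ≡⟨ cong (λ x → (toℕ a + x) % p) (toℕ-fromℕ< (m%n<n (p ∸ toℕ a) p)) ⟩
    (toℕ a + (p ∸ toℕ a) % p) % p       ≡⟨ [m+n%d]%d≡[m+n]%d (toℕ a) (p ∸ toℕ a) p ⟩
    (toℕ a + (p ∸ toℕ a)) % p           ≡⟨ cong (_% p) (m+[n∸m]≡n (<⇒≤ (toℕ<n a))) ⟩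
    p % p                               ≡⟨ n%n≡0 p ⟩
    0                                   ≡⟨ toℕ-𝟘 ⟨
    toℕ 𝟘                               ∎)

  ⊕-abelianGroup : AbelianGroup 0ℓ 0ℓ
  ⊕-abelianGroup = record
    { Carrier        = Fin p
    ; _≈_            = _≡_
    ; _∙_            = _⊕_
    ; ε              = 𝟘
    ; _⁻¹            = ⊖_
    ; isAbelianGroup = record
      { isGroup = record
        { isMonoid = record
          { isSemigroup = record { isMagma = isMagma _⊕_ ; assoc = ⊕-assoc }
          ; identity    = (λ a → trans (⊕-comm 𝟘 a) (⊕-identityʳ a)) , ⊕-identityʳ
          }
        ; inverse = (λ a → trans (⊕-comm (⊖ a) a) (⊕-inverseʳ a)) , ⊕-inverseʳ
        ; ⁻¹-cong = cong ⊖_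
        }
      ; comm = ⊕-comm
      }
    }

  open AbelianGroup ⊕-abelianGroup using (group; commutativeSemigroup)
  open GroupProperties group using (∙-cancelʳ; x∙y⁻¹≈ε⇒x≈y)
  open CommutativeSemigroupProperties commutativeSemigroup using (interchange)

  double≡𝟘⇒≡𝟘 : ¬ 2 ∣ p → ∀ (a : Fin p) → a ⊕ a ≡ 𝟘 → a ≡ 𝟘
  double≡𝟘⇒≡𝟘 2∤p a a⊕a≡𝟘 = toℕ-injective (trans toℕa≡0 (sym toℕ-𝟘))
    where
    [a+a]%p≡0 : (toℕ a + toℕ a) % p ≡ 0
    [a+a]%p≡0 = trans (sym (toℕ-⊕ a a)) (trans (cong toℕ a⊕a≡𝟘) toℕ-𝟘)
    toℕa≡0 : toℕ a ≡ 0
    toℕa≡0 = ∣∧<⇒≡0 (odd-∣-double⇒∣ 2∤p (m%n≡0⇒n∣m _ p [a+a]%p≡0)) (toℕ<n a)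

  ⊕-double-injective : ¬ 2 ∣ p → ∀ {a b : Fin p} → a ⊕ a ≡ b ⊕ b → a ≡ b
  ⊕-double-injective 2∤p {a} {b} a⊕a≡b⊕b = x∙y⁻¹≈ε⇒x≈y a b (double≡𝟘⇒≡𝟘 2∤p (a ⊕ ⊖ b) (begin
    (a ⊕ ⊖ b) ⊕ (a ⊕ ⊖ b) ≡⟨ interchange a (⊖ b) a (⊖ b) ⟩
    (a ⊕ a) ⊕ (⊖ b ⊕ ⊖ b) ≡⟨ cong (_⊕ (⊖ b ⊕ ⊖ b)) a⊕a≡b⊕b ⟩
    (b ⊕ b) ⊕ (⊖ b ⊕ ⊖ b) ≡⟨ interchange b b (⊖ b) (⊖ b) ⟩
    (b ⊕ ⊖ b) ⊕ (b ⊕ ⊖ b) ≡⟨ cong₂ _⊕_ (⊕-inverseʳ b) (⊕-inverseʳ b) ⟩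
    𝟘 ⊕ 𝟘                 ≡⟨ ⊕-identityʳ 𝟘 ⟩
    𝟘                     ∎))

  ⊕-determined-by-pair-sums : ¬ 2 ∣ p → ∀ (x y z x′ y′ z′ : Fin p) →
    x ⊕ y ≡ x′ ⊕ y′ → x ⊕ z ≡ x′ ⊕ z′ → y ⊕ z ≡ y′ ⊕ z′ → x ≡ x′
  ⊕-determined-by-pair-sums 2∤p x y z x′ y′ z′ xy xz yz =
    ⊕-double-injective 2∤p (∙-cancelʳ (y ⊕ z) (x ⊕ x) (x′ ⊕ x′) (begin
      (x ⊕ x) ⊕ (y ⊕ z)     ≡⟨ interchange x y x z ⟨
      (x ⊕ y) ⊕ (x ⊕ z)     ≡⟨ cong₂ _⊕_ xy xz ⟩
      (x′ ⊕ y′) ⊕ (x′ ⊕ z′) ≡⟨ interchange x′ y′ x′ z′ ⟩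
      (x′ ⊕ x′) ⊕ (y′ ⊕ z′) ≡⟨ cong ((x′ ⊕ x′) ⊕_) yz ⟨
      (x′ ⊕ x′) ⊕ (y ⊕ z)   ∎))

  pairSums : Cube p → Cube p
  pairSums (x , y , z) = y ⊕ z , x ⊕ z , x ⊕ y

  pairSums-injective : ¬ 2 ∣ p → Injective _≡_ _≡_ pairSums
  pairSums-injective 2∤p {x , y , z} {x′ , y′ , z′} eq
    with yz , xz,xy ← ,-injective eq
    with xz , xy ← ,-injective xz,xy
    = cong₂ _,_ (determined x y z x′ y′ z′ xy xz yz)
        (cong₂ _,_ (determined y x z y′ x′ z′ (swap x y x′ y′ xy) yz xz)
                   (determined z x y z′ x′ y′ (swap x z x′ z′ xz) (swap y z y′ z′ yz) xy))
    where
    determined = ⊕-determined-by-pair-sums 2∤p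
    swap : ∀ (a b a′ b′ : Fin p) → a ⊕ b ≡ a′ ⊕ b′ → b ⊕ a ≡ b′ ⊕ a′
    swap a b a′ b′ e = trans (⊕-comm b a) (trans e (⊕-comm a′ b′))

  corners : Tile p → Cube p
  corners (up x y z)   = x , y , z
  corners (down x y z) = x , y , z

  upCube downCube : Cube p → Tile p
  upCube   (x , y , z) = up x y z
  downCube (x , y , z) = down x y z

  α-injective : ¬ 2 ∣ p → Injective _≡_ _≡_ α
  α-injective 2∤p {up x y z} {up x′ y′ z′} eq =
    cong upCube (pairSums-injective 2∤p {x , y , z} {x′ , y′ , z′} (cong corners eq))
  α-injective 2∤p {down x y z} {down x′ y′ z′} eq =
    cong downCube (pairSums-injective 2∤p {x , y , z} {x′ , y′ , z′} (cong corners eq))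
  α-injective 2∤p {up _ _ _}   {down _ _ _} ()
  α-injective 2∤p {down _ _ _} {up _ _ _}   ()

  α^≡fold : ∀ k t → α^ k t ≡ fold t α k
  α^≡fold zero    t = refl
  α^≡fold (suc k) t = cong α (α^≡fold k t)

  α^-+ : ∀ m n t → α^ (m + n) t ≡ α^ m (α^ n t)
  α^-+ zero    n t = refl
  α^-+ (suc m) n t = cong α (α^-+ m n t)

  α^-comm : ∀ m n t → α^ m (α^ n t) ≡ α^ n (α^ m t)
  α^-comm m n t = begin
    α^ m (α^ n t) ≡⟨ α^-+ m n t ⟨
    α^ (m + n) t  ≡⟨ cong (λ k → α^ k t) (+-comm m n) ⟩
    α^ (n + m) t  ≡⟨ α^-+ n m t ⟩
    α^ n (α^ m t) ∎

  α^-injective : ¬ 2 ∣ p → ∀ k → Injective _≡_ _≡_ (α^ k)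
  α^-injective 2∤p zero    eq = eq
  α^-injective 2∤p (suc k) eq = α^-injective 2∤p k (α-injective 2∤p eq)

  α-periodic : ¬ 2 ∣ p → ∀ t → ∃[ m ] (m ≥ 1 × α^ m t ≡ t)
  α-periodic 2∤p t
    with m , m≥1 , foldₘ≡t ← injective⇒periodic (α-injective 2∤p) (↔⇒↣ Tile↔Fin) t
    = m , m≥1 , trans (α^≡fold m t) foldₘ≡t

  α^-period-of-preimage : ¬ 2 ∣ p → ∀ {m k t u} → α^ m t ≡ t → α^ k u ≡ t → α^ m u ≡ u
  α^-period-of-preimage 2∤p {m} {k} {t} {u} αᵐt≡t αᵏu≡t = α^-injective 2∤p k (begin
    α^ k (α^ m u) ≡⟨ α^-comm k m u ⟩
    α^ m (α^ k u) ≡⟨ cong (α^ m) αᵏu≡t ⟩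
    α^ m t        ≡⟨ αᵐt≡t ⟩
    t             ≡⟨ αᵏu≡t ⟨
    α^ k u        ∎)

  infix 4 _⊆_
  _⊆_ : Tiling p → Tiling p → Set
  R ⊆ R′ = ∀ {Q τ} → R Q τ → R′ Q τ

  ⊆-reflexive : ∀ {R R′ : Tiling p} → R ≡ R′ → R ⊆ R′
  ⊆-reflexive refl r = r

  σ^-mono : ∀ n {R R′ : Tiling p} → R ⊆ R′ → σ^ n R ⊆ σ^ n R′
  σ^-mono zero    R⊆R′ r                 = R⊆R′ r
  σ^-mono (suc n) R⊆R′ (P , t , r , ∈ch) = P , t , σ^-mono n R⊆R′ r , ∈ch

  σ^-+ : ∀ m n (R : Tiling p) → σ^ (m + n) R ≡ σ^ m (σ^ n R)
  σ^-+ zero    n R = refl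
  σ^-+ (suc m) n R = cong σ (σ^-+ m n R)

  σ^-comm : ∀ m n (R : Tiling p) → σ^ m (σ^ n R) ≡ σ^ n (σ^ m R)
  σ^-comm m n R = begin
    σ^ m (σ^ n R) ≡⟨ σ^-+ m n R ⟨
    σ^ (m + n) R  ≡⟨ cong (λ k → σ^ k R) (+-comm m n) ⟩
    σ^ (n + m) R  ≡⟨ σ^-+ n m R ⟩
    σ^ n (σ^ m R) ∎

  σ^-∃ : ∀ n {I : Set} (R : I → Tiling p) →
    σ^ n (λ Q τ → ∃[ i ] R i Q τ) ⊆ (λ Q τ → ∃[ i ] σ^ n (R i) Q τ)
  σ^-∃ zero    R r = r
  σ^-∃ (suc n) R (P , t , r , ∈ch) with i , r′ ← σ^-∃ n R r = i , P , t , r′ , ∈ch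

  σ^-×ˡ : ∀ n {A : Set} (R : Tiling p) → σ^ n (λ Q τ → A × R Q τ) ⊆ (λ Q τ → A × σ^ n R Q τ)
  σ^-×ˡ zero    R r = r
  σ^-×ˡ (suc n) R (P , t , r , ∈ch) with a , r′ ← σ^-×ˡ n R r = a , P , t , r′ , ∈ch

  α∈children : ∀ t → (origin , α t) ∈ children origin t
  α∈children (up _ _ _)   = there (there (there (here refl)))
  α∈children (down _ _ _) = there (there (there (here refl)))

  single⊆σ^ : ∀ m {u v} → α^ m u ≡ v → single v ⊆ σ^ m (single u)
  single⊆σ^ zero    refl r             = r
  single⊆σ^ (suc m) refl (refl , refl) =
    origin , α^ m _ , single⊆σ^ m refl (refl , refl) , α∈children (α^ m _)

  σ^-s⊆s : ∀ {m k t} → α^ m t ≡ t → σ^ m (s t k) ⊆ s t (m + k)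
  σ^-s⊆s {m} {k} {t} αᵐt≡t r
    with u , r′ ← σ^-∃ m (λ u Q τ → (α^ k u ≡ t) × σ^ k (single u) Q τ) r
    with αᵏu≡t , r″ ← σ^-×ˡ m (σ^ k (single u)) r′
    = u , trans (α^-+ m k u) (trans (cong (α^ m) αᵏu≡t) αᵐt≡t)
        , ⊆-reflexive (sym (σ^-+ m k (single u))) r″

  σ^-S⊆S : ∀ {m t} → α^ m t ≡ t → σ^ m (S t) ⊆ S t
  σ^-S⊆S {m} {t} αᵐt≡t r with k , r′ ← σ^-∃ m (s t) r = m + k , σ^-s⊆s {m} {k} {t} αᵐt≡t r′

  S⊆σ^-S : ¬ 2 ∣ p → ∀ {m t} → α^ m t ≡ t → S t ⊆ σ^ m (S t)
  S⊆σ^-S 2∤p {m} {t} αᵐt≡t (k , u , αᵏu≡t , r) =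
    σ^-mono m (λ r′ → k , u , αᵏu≡t , r′)
      (⊆-reflexive (σ^-comm k m (single u))
        (σ^-mono k (single⊆σ^ m (α^-period-of-preimage 2∤p {m} {k} {t} {u} αᵐt≡t αᵏu≡t)) r))

mainTheorem3 : (p : ℕ) .{{_ : NonZero p}} → Prime p → ¬ (2 ∣ p) →
    (t : Tile p) → NonZeroTile t →
    ∃[ n ] ((n ≥ 1) × (σ^ n (S t) ≐ S t))
mainTheorem3 p _ 2∤p t _ with m , m≥1 , αᵐt≡t ← α-periodic 2∤p t =
  m , m≥1 , λ _ _ → σ^-S⊆S {m = m} {t = t} αᵐt≡t , S⊆σ^-S 2∤p {m = m} {t = t} αᵐt≡t
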